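{- Let $\mathbf A\in\mathbf{I}_{2,0}$ and $a,b\in A$. If $0\sqsubseteq a$ and $0\sqsubseteq b$, then $0\sqsubseteq a\to b$.
   Context: A zroupoid is an algebra $\langle A,\to,0\rangle$ with binary $\to$ and constant $0$; $x':=x\to 0$. An implication zroupoid satisfies (I) $(x\to y)\to z\approx[(z'\to x)\to(y\to z)']'$ and $0''\approx 0$; $\mathbf{I}_{2,0}$ is the variety of implication zroupoids satisfying $x''\approx x$. For $x,y\in A$, $x\sqsubseteq y$ iff $(x\to y')'=x$. -}

module Defs where

open import Level using (Level; suc)
open import Relation.Binary.PropositionalEquality using (_≡_)

record Zroupoid (ℓ : Level) : Set (suc ℓ) where
  infixr 5 _⇒_
  field
    Carrier : Set ℓ
    _⇒_     : Carrier → Carrier → Carrier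
    𝟘       : Carrier

  _′ : Carrier → Carrier
  x ′ = x ⇒ 𝟘

  _⊑_ : Carrier → Carrier → Set ℓ
  x ⊑ y = ((x ⇒ (y ′)) ′) ≡ x

record I₂₀ (ℓ : Level) : Set (suc ℓ) where
  field
    zroupoid : Zroupoid ℓ
  open Zroupoid zroupoid public
  field
    identityI : ∀ x y z → ((x ⇒ y) ⇒ z) ≡ ((((z ′) ⇒ x) ⇒ ((y ⇒ z) ′)) ′)
    zero″     : ((𝟘 ′) ′) ≡ 𝟘
    involutive : ∀ x → ((x ′) ′) ≡ x

module Submission where

-- Write 1 := 0′ and call an element y *full* when
-- 0 → y = 1.  In I₂₀ the relation 0 ⊑ y says exactly that y′ is full, and
-- fullness is invariant under ′, so 0 ⊑ y holds iff y is full.  The theorem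
-- thus reads: full elements are closed under →.
--
-- From these: a full y
-- satisfies (x → y) → x = x; fullness passes to and from y′; and a full a
-- lets one cancel "→ a" under 0 → (_)′.  For full a, b this gives
--   0 → (a → b) = 0 → ((a → b) → a)′ = 0 → a′ = 1,
-- which is the theorem after translating ⊑ into fullness.

open import Defs
open import Level using (Level)
open import Relation.Binary.PropositionalEquality using (_≡_; sym; cong; module ≡-Reasoning)

module Properties {ℓ : Level} (A : I₂₀ ℓ) where
  open I₂₀ A
  open ≡-Reasoning

  𝟙 : Carrier
  𝟙 = 𝟘 ′

  𝟙′ : 𝟙 ′ ≡ 𝟘
  𝟙′ = involutive 𝟘

  ′-swap : ∀ {x y} → x ′ ≡ y → x ≡ y ′
  ′-swap {x} {y} eq = begin
    x       ≡⟨ sym (involutive x) ⟩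
    x ′ ′   ≡⟨ cong _′ eq ⟩
    y ′     ∎

  identityI-𝟘 : ∀ y z → (𝟘 ⇒ y) ⇒ z ≡ (z ⇒ (y ⇒ z) ′) ′
  identityI-𝟘 y z = begin
    (𝟘 ⇒ y) ⇒ z                   ≡⟨ identityI 𝟘 y z ⟩
    ((z ′ ⇒ 𝟘) ⇒ (y ⇒ z) ′) ′     ≡⟨ cong (λ w → (w ⇒ (y ⇒ z) ′) ′) (involutive z) ⟩
    (z ⇒ (y ⇒ z) ′) ′             ∎

  𝟙-identityˡ : ∀ x → 𝟙 ⇒ x ≡ x
  𝟙-identityˡ x = sym (begin
    x                           ≡⟨ sym (involutive x) ⟩
    (x ⇒ 𝟘) ⇒ 𝟘                 ≡⟨ identityI x 𝟘 𝟘 ⟩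
    ((𝟙 ⇒ x) ⇒ 𝟙 ′) ′           ≡⟨ cong (λ w → ((𝟙 ⇒ x) ⇒ w) ′) 𝟙′ ⟩
    (𝟙 ⇒ x) ′ ′                 ≡⟨ involutive (𝟙 ⇒ x) ⟩
    𝟙 ⇒ x                       ∎)

  𝟘⇒𝟙 : 𝟘 ⇒ 𝟙 ≡ 𝟙
  𝟘⇒𝟙 = ′-swap (begin
    (𝟘 ⇒ 𝟙) ′                   ≡⟨ sym (𝟙-identityˡ ((𝟘 ⇒ 𝟙) ′)) ⟩
    𝟙 ⇒ (𝟘 ⇒ 𝟙) ′               ≡⟨ ′-swap (sym (identityI-𝟘 𝟘 𝟙)) ⟩
    (𝟙 ⇒ 𝟙) ′                   ≡⟨ cong _′ (𝟙-identityˡ 𝟙) ⟩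
    𝟙 ′                         ≡⟨ 𝟙′ ⟩
    𝟘                           ∎)

  ⇒′-self : ∀ x → x ⇒ x ′ ≡ x ′
  ⇒′-self x = ′-swap (sym (begin
    x                           ≡⟨ sym (𝟙-identityˡ x) ⟩
    𝟙 ⇒ x                       ≡⟨ cong (_⇒ x) (sym 𝟘⇒𝟙) ⟩
    (𝟘 ⇒ 𝟙) ⇒ x                 ≡⟨ identityI-𝟘 𝟙 x ⟩
    (x ⇒ (𝟙 ⇒ x) ′) ′           ≡⟨ cong (λ w → (x ⇒ w ′) ′) (𝟙-identityˡ x) ⟩
    (x ⇒ x ′) ′                 ∎))

  ′⇒-self : ∀ x → x ′ ⇒ x ≡ x
  ′⇒-self x = begin
    x ′ ⇒ x                     ≡⟨ cong (x ′ ⇒_) (sym (involutive x)) ⟩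
    x ′ ⇒ x ′ ′                 ≡⟨ ⇒′-self (x ′) ⟩
    x ′ ′                       ≡⟨ involutive x ⟩
    x                           ∎

  absorption-shift : ∀ x y → (𝟘 ⇒ y) ⇒ x ≡ (x ⇒ y) ⇒ x
  absorption-shift x y = begin
    (𝟘 ⇒ y) ⇒ x                   ≡⟨ identityI-𝟘 y x ⟩
    (x ⇒ (y ⇒ x) ′) ′             ≡⟨ cong (λ w → (w ⇒ (y ⇒ x) ′) ′) (sym (′⇒-self x)) ⟩
    ((x ′ ⇒ x) ⇒ (y ⇒ x) ′) ′     ≡⟨ sym (identityI x y x) ⟩
    (x ⇒ y) ⇒ x                   ∎

  ′⇒𝟙 : ∀ x → x ′ ⇒ 𝟙 ≡ 𝟘 ⇒ x
  ′⇒𝟙 x = begin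
    x ′ ⇒ 𝟙                       ≡⟨ identityI x 𝟘 𝟙 ⟩
    ((𝟙 ′ ⇒ x) ⇒ (𝟘 ⇒ 𝟙) ′) ′     ≡⟨ cong (λ w → ((w ⇒ x) ⇒ (𝟘 ⇒ 𝟙) ′) ′) 𝟙′ ⟩
    ((𝟘 ⇒ x) ⇒ (𝟘 ⇒ 𝟙) ′) ′       ≡⟨ cong (λ w → ((𝟘 ⇒ x) ⇒ w ′) ′) 𝟘⇒𝟙 ⟩
    ((𝟘 ⇒ x) ⇒ 𝟙 ′) ′             ≡⟨ cong (λ w → ((𝟘 ⇒ x) ⇒ w) ′) 𝟙′ ⟩
    (𝟘 ⇒ x) ′ ′                   ≡⟨ involutive (𝟘 ⇒ x) ⟩
    𝟘 ⇒ x                         ∎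

  ⇒𝟙 : ∀ x → x ⇒ 𝟙 ≡ 𝟘 ⇒ x ′
  ⇒𝟙 x = begin
    x ⇒ 𝟙                         ≡⟨ cong (_⇒ 𝟙) (sym (involutive x)) ⟩
    x ′ ′ ⇒ 𝟙                     ≡⟨ ′⇒𝟙 (x ′) ⟩
    𝟘 ⇒ x ′                       ∎

  Full : Carrier → Set ℓ
  Full y = 𝟘 ⇒ y ≡ 𝟙

  full-absorbs : ∀ {y} → Full y → ∀ x → (x ⇒ y) ⇒ x ≡ x
  full-absorbs {y} full-y x = begin
    (x ⇒ y) ⇒ x                   ≡⟨ sym (absorption-shift x y) ⟩
    (𝟘 ⇒ y) ⇒ x                   ≡⟨ cong (_⇒ x) full-y ⟩
    𝟙 ⇒ x                         ≡⟨ 𝟙-identityˡ x ⟩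
    x                             ∎

  full⇒𝟙 : ∀ {y} → Full y → y ⇒ 𝟙 ≡ 𝟙
  full⇒𝟙 {y} full-y = begin
    y ⇒ 𝟙                         ≡⟨ cong (_⇒ 𝟙) (sym (𝟙-identityˡ y)) ⟩
    (𝟙 ⇒ y) ⇒ 𝟙                   ≡⟨ full-absorbs full-y 𝟙 ⟩
    𝟙                             ∎

  full-′ : ∀ {y} → Full y → Full (y ′)
  full-′ {y} full-y = begin
    𝟘 ⇒ y ′                       ≡⟨ sym (⇒𝟙 y) ⟩
    y ⇒ 𝟙                         ≡⟨ full⇒𝟙 full-y ⟩
    𝟙                             ∎

  full-from-′ : ∀ {y} → Full (y ′) → Full y
  full-from-′ {y} full-y′ = begin
    𝟘 ⇒ y                         ≡⟨ sym (′⇒𝟙 y) ⟩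
    y ′ ⇒ 𝟙                       ≡⟨ full⇒𝟙 full-y′ ⟩
    𝟙                             ∎

  ⊑⇒full′ : ∀ {y} → 𝟘 ⊑ y → Full (y ′)
  ⊑⇒full′ = ′-swap

  full′⇒⊑ : ∀ {y} → Full (y ′) → 𝟘 ⊑ y
  full′⇒⊑ {y} full-y′ = begin
    (𝟘 ⇒ y ′) ′                   ≡⟨ cong _′ full-y′ ⟩
    𝟙 ′                           ≡⟨ 𝟙′ ⟩
    𝟘                             ∎

  𝟘⇒-cancel : ∀ {a} → Full a → ∀ x → 𝟘 ⇒ (x ⇒ a) ′ ≡ 𝟘 ⇒ x
  𝟘⇒-cancel {a} full-a x = begin
    𝟘 ⇒ (x ⇒ a) ′                 ≡⟨ sym (⇒𝟙 (x ⇒ a)) ⟩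
    (x ⇒ a) ⇒ 𝟙                   ≡⟨ identityI x a 𝟙 ⟩
    ((𝟙 ′ ⇒ x) ⇒ (a ⇒ 𝟙) ′) ′     ≡⟨ cong (λ w → ((w ⇒ x) ⇒ (a ⇒ 𝟙) ′) ′) 𝟙′ ⟩
    ((𝟘 ⇒ x) ⇒ (a ⇒ 𝟙) ′) ′       ≡⟨ cong (λ w → ((𝟘 ⇒ x) ⇒ w ′) ′) (full⇒𝟙 full-a) ⟩
    ((𝟘 ⇒ x) ⇒ 𝟙 ′) ′             ≡⟨ cong (λ w → ((𝟘 ⇒ x) ⇒ w) ′) 𝟙′ ⟩
    (𝟘 ⇒ x) ′ ′                   ≡⟨ involutive (𝟘 ⇒ x) ⟩
    𝟘 ⇒ x                         ∎

  full-⇒ : ∀ {a b} → Full a → Full b → Full (a ⇒ b)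
  full-⇒ {a} {b} full-a full-b = begin
    𝟘 ⇒ (a ⇒ b)                   ≡⟨ sym (𝟘⇒-cancel full-a (a ⇒ b)) ⟩
    𝟘 ⇒ ((a ⇒ b) ⇒ a) ′           ≡⟨ cong (λ w → 𝟘 ⇒ w ′) (full-absorbs full-b a) ⟩
    𝟘 ⇒ a ′                       ≡⟨ full-′ full-a ⟩
    𝟙                             ∎

lemma5p4 : {ℓ : Level} (A : I₂₀ ℓ) → let open I₂₀ A in
    ∀ (a b : Carrier) → 𝟘 ⊑ a → 𝟘 ⊑ b → 𝟘 ⊑ (a ⇒ b)
lemma5p4 A a b 𝟘⊑a 𝟘⊑b = full′⇒⊑ (full-′ (full-⇒ full-a full-b))
  where
  open Properties A
  full-a : Full a
  full-a = full-from-′ (⊑⇒full′ 𝟘⊑a)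
  full-b : Full b
  full-b = full-from-′ (⊑⇒full′ 𝟘⊑b)
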